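{- Let $1\le n\le N-1$ and let $U_0\xrightarrow{K_1}U_1\xrightarrow{K_2}\cdots\xrightarrow{K_r}U_r$ be a (not necessarily maximal) chain of edges in the higher Bruhat order $B(N,n)$, i.e. each $U_s$ is a consistent subset of $\binom{[N]}{n+1}$ and $U_s=U_{s-1}\cup\{K_s\}$ with $K_s\notin U_{s-1}$. If at least one of the edges $U_{s-1}\xrightarrow{K_s}U_s$ is visible, then $R(U_0)\neq R(U_r)$.
   Context: $[N]=\{1,\ldots,N\}$ and $\binom{[N]}{m}$ is the set of $m$-element subsets. For $S=\{s_1<\cdots<s_q\}$, $q\ge2$, let $S_>=\{s_j:j\equiv q\pmod 2\}$ and $S_<=\{s_j:j\equiv q-1\pmod 2\}$. For $L\in\binom{[N]}{m+1}$, $L=\{l_1<\cdots<l_{m+1}\}$, its packet is $P(L)=\binom{L}{m}$, and its lexicographic order is $L\setminus\{l_{m+1}\},L\setminus\{l_m\},\ldots,L\setminus\{l_1\}$; a beginning (resp. ending) segment of $P(L)$ is an initial (resp. final) segment of this order ($\emptyset$ and $P(L)$ count as both). A subset $U\subset\binom{[N]}{n+1}$ is consistent if for every $L\in\binom{[N]}{n+2}$, $U\cap P(L)$ is a beginning or an ending segment. $B(N,n)$ is the set of consistent subsets ordered by the relation generated by single-step inclusion; a covering pair $U\subset U'=U\cup\{K\}$ is an edge $U\xrightarrow{K}U'$. The edge is non-visible if there exist $L\in\binom{[N]}{n+2}$ and $l\in L$ with $K=L\setminus\{l\}$ such that either $l\in L_<$ and both $U\cap P(L)$, $U'\cap P(L)$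 are beginning segments, or $l\in L_>$ and both are ending segments; otherwise it is visible. For consistent $U$, let $A_U$ be the (nonempty) set of linear orders of $\binom{[N]}{n}$ in which, for every $K'\in\binom{[N]}{n+1}$, $P(K')$ appears in lexicographic order if $K'\notin U$ and in reverse lexicographic order if $K'\in U$; $Q(U)$ is the partial order on $\binom{[N]}{n}$ with $I'<I$ iff $I'$ precedes $I$ in every order of $A_U$. $I\in\binom{[N]}{n}$ is non-visible for $U$ if there are $K'\in\binom{[N]}{n+1}$ and $k\in K'$ with $I=K'\setminus\{k\}$ and either ($K'\notin U$ and $k\in K'_<$) or ($K'\in U$ and $k\in K'_>$). $R(U)$ is the subposet of $Q(U)$ induced on the elements not non-visible for $U$. -}

module Defs where

open import Data.Nat using (ℕ; suc; _∸_; _%_; _<_; _≤_; _<ᵇ_)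
open import Data.Bool using (Bool; true; false)
open import Data.Fin using (Fin; toℕ)
open import Data.Fin.Subset using (Subset; ∣_∣; _∩_; _-_; _∈_)
open import Data.Vec using (tabulate)
open import Data.List using (List; _∷_; _++_)
open import Data.List.Relation.Unary.Unique.Propositional using (Unique)
open import Data.List.Membership.Propositional renaming (_∈_ to _∈ˡ_)
open import Data.Product using (Σ; _×_; ∃; ∃-syntax)
open import Data.Sum using (_⊎_)
open import Relation.Binary.PropositionalEquality using (_≡_)
open import Relation.Nullary using (¬_)

-- [N] is modelled by Fin N (ordered by toℕ); subsets of [N] by Subset N.
-- A family of subsets (e.g. U ⊂ binom([N],n+1)) is a Bool-valued membership test.
Family : ℕ → Set
Family N = Subset N → Bool

_∈F_ : ∀ {N} → Subset N → Family N → Set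
X ∈F U = U X ≡ true

_∉F_ : ∀ {N} → Subset N → Family N → Set
X ∉F U = U X ≡ false

_<ᶠ_ : ∀ {N} → Fin N → Fin N → Set
a <ᶠ b = toℕ a < toℕ b

below : ∀ {N} → Fin N → Subset N
below k = tabulate (λ x → toℕ x <ᵇ toℕ k)

-- position j of k in S = {s_1 < ... < s_q}  (k = s_j)
pos : ∀ {N} → Subset N → Fin N → ℕ
pos S k = suc ∣ S ∩ below k ∣

InGt : ∀ {N} → Subset N → Fin N → Set
InGt S k = k ∈ S × (pos S k % 2 ≡ ∣ S ∣ % 2)

InLt : ∀ {N} → Subset N → Fin N → Set
InLt S k = k ∈ S × (pos S k % 2 ≡ (∣ S ∣ ∸ 1) % 2)

-- U ∩ P(L) is a beginning segment of P(L) in the lexicographic order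
-- L∖{l_{m+1}}, L∖{l_m}, …, L∖{l_1}  (i.e. it is closed downwards in that order)
Beginning : ∀ {N} → Family N → Subset N → Set
Beginning U L = ∀ l l' → l ∈ L → l' ∈ L → l <ᶠ l' →
  (L - l) ∈F U → (L - l') ∈F U

Ending : ∀ {N} → Family N → Subset N → Set
Ending U L = ∀ l l' → l ∈ L → l' ∈ L → l <ᶠ l' →
  (L - l') ∈F U → (L - l) ∈F U

Consistent : (N n : ℕ) → Family N → Set
Consistent N n U =
  (∀ X → X ∈F U → ∣ X ∣ ≡ suc n) ×
  (∀ (L : Subset N) → ∣ L ∣ ≡ suc (suc n) → Beginning U L ⊎ Ending U L)

NonVisibleEdge : (N n : ℕ) → Family N → Subset N → Family N → Set
NonVisibleEdge N n U K U' =
  Σ (Subset N) λ L → ∣ L ∣ ≡ suc (suc n) × Σ (Fin N) λ l → l ∈ L × K ≡ L - l ×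
    ((InLt L l × Beginning U L × Beginning U' L) ⊎
     (InGt L l × Ending U L × Ending U' L))

Precedes : ∀ {N} → List (Subset N) → Subset N → Subset N → Set
Precedes xs a b = Σ (List _) λ ys → Σ (List _) λ zs → xs ≡ ys ++ a ∷ zs × b ∈ˡ zs

LinearOrder : (N n : ℕ) → List (Subset N) → Set
LinearOrder N n xs =
  Unique xs × (∀ I → I ∈ˡ xs → ∣ I ∣ ≡ n) × (∀ I → ∣ I ∣ ≡ n → I ∈ˡ xs)

InA : (N n : ℕ) → Family N → List (Subset N) → Set
InA N n U xs = LinearOrder N n xs ×
  (∀ (K' : Subset N) → ∣ K' ∣ ≡ suc n → ∀ k k' → k ∈ K' → k' ∈ K' → k <ᶠ k' →
     (K' ∉F U → Precedes xs (K' - k') (K' - k)) ×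
     (K' ∈F U → Precedes xs (K' - k) (K' - k')))

QLess : (N n : ℕ) → Family N → Subset N → Subset N → Set
QLess N n U I' I = ∀ xs → InA N n U xs → Precedes xs I' I

NonVisible : (N n : ℕ) → Family N → Subset N → Set
NonVisible N n U I =
  Σ (Subset N) λ K' → ∣ K' ∣ ≡ suc n × Σ (Fin N) λ k → k ∈ K' × I ≡ K' - k ×
    ((K' ∉F U × InLt K' k) ⊎ (K' ∈F U × InGt K' k))

InR : (N n : ℕ) → Family N → Subset N → Set
InR N n U I = ∣ I ∣ ≡ n × ¬ NonVisible N n U I

SameR : (N n : ℕ) → Family N → Family N → Set
SameR N n U V =
  (∀ I → (InR N n U I → InR N n V I) × (InR N n V I → InR N n U I)) ×
  (∀ I' I → InR N n U I' → InR N n U I →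
     (QLess N n U I' I → QLess N n V I' I) × (QLess N n V I' I → QLess N n U I' I))

module Submission where

-- We show that already the element sets of the two posets differ.
--
-- (A) Across a visible edge U --K--> U', the set K ∖ {k} is visible for U' for
--     every k ∈ K_<; it is non-visible for U₀ as soon as K ∉ U₀.
-- (B) Across a non-visible edge U --K--> U', every K ∖ {x} is non-visible for U.
-- Hence an n-set visible for U and non-visible for U' can only be lost through a
-- visible edge, and that edge produces a fresh set by (A).  Starting from the
-- visible edge at step s, the invariant "some set is visible for U_t but not for
-- U₀" therefore propagates up to t = r; as visibility is not decidable here, the
-- invariant is carried in double-negated form, which suffices for a negation.

open import Defs
open import Data.Nat using (ℕ; zero; suc; _≤_; _<_; _∸_; _%_; z≤n; s≤s)
open import Data.Nat.Properties using (suc-injective; ≤-trans; ≤-refl; n≤1+n; m∸n≤m; m≤n⇒m<n∨m≡n; <-asym; 0≢1+n; 1+n≢0)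
open import Data.Bool using (Bool; true; false; not)
open import Data.Bool.Properties using (¬-not; not-¬) renaming (_≟_ to _≟ᵇ_)
open import Data.Fin using (Fin; zero; suc) renaming (_≟_ to _≟ᶠ_)
open import Data.Fin.Properties using (<-cmp)
open import Data.Fin.Subset using (Subset; ∣_∣; _∩_; _∪_; _-_; _∈_; _∉_; ⁅_⁆; _⊆_)
open import Data.Fin.Subset.Properties using (p─⊥≡p; p─q⊆p; x∈p∧x≢y⇒x∈p-y; ⊆-antisym; x∈p∩q⁺; x∈p∩q⁻; x∈p∪q⁺; x∈p∪q⁻; x∈⁅x⁆; x∈⁅y⁆⇒x≡y; p─x─y≡p─y─x)
open import Data.Vec using ([]; _∷_; tabulate)
open import Data.Vec.Base using (here; there)
open import Data.Vec.Properties using (≡-dec)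
open import Data.Product using (Σ; _×_; _,_; proj₁; proj₂)
open import Data.Sum using (_⊎_; inj₁; inj₂; swap)
open import Data.Empty using (⊥; ⊥-elim)
open import Function using (flip)
open import Level using (0ℓ)
open import Relation.Binary.Core using (Rel)
open import Relation.Binary.Definitions using (Trichotomous; Tri; tri<; tri≈; tri>)
open import Relation.Binary.Consequences using (tri⇒irr)
import Relation.Binary.Construct.Flip.EqAndOrd as Flip
open import Relation.Binary.PropositionalEquality using (_≡_; _≢_; refl; sym; trans; cong; subst; subst₂)
open import Relation.Nullary using (¬_; yes; no; Dec)

_≟ˢ_ : ∀ {N} (p q : Subset N) → Dec (p ≡ q)
_≟ˢ_ = ≡-dec _≟ᵇ_

x∉p-x : ∀ {N} (p : Subset N) x → x ∉ p - x
x∉p-x (_ ∷ p) zero ()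
x∉p-x (_ ∷ p) (suc x) (there x∈) = x∉p-x p x x∈

∈-minus⁻ : ∀ {N} {p : Subset N} {x y} → x ∈ p - y → x ∈ p × x ≢ y
∈-minus⁻ {p = p} {x} {y} x∈ = p─q⊆p p ⁅ y ⁆ x∈ , λ { refl → x∉p-x p x x∈ }

∣p∣≡1+∣p-x∣ : ∀ {N} (p : Subset N) x → x ∈ p → ∣ p ∣ ≡ suc ∣ p - x ∣
∣p∣≡1+∣p-x∣ (true ∷ p) zero here = cong suc (sym (cong ∣_∣ (p─⊥≡p p)))
∣p∣≡1+∣p-x∣ (true ∷ p) (suc x) (there x∈) = cong suc (∣p∣≡1+∣p-x∣ p x x∈)
∣p∣≡1+∣p-x∣ (false ∷ p) (suc x) (there x∈) = ∣p∣≡1+∣p-x∣ p x x∈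

p-x≡p : ∀ {N} (p : Subset N) x → x ∉ p → p - x ≡ p
p-x≡p (true ∷ p) zero x∉ = ⊥-elim (x∉ here)
p-x≡p (false ∷ p) zero _ = cong (false ∷_) (p─⊥≡p p)
p-x≡p (b ∷ p) (suc x) x∉ = cong (b ∷_) (p-x≡p p x (λ x∈ → x∉ (there x∈)))

minus-injective : ∀ {N} (L : Subset N) a b → a ∈ L → L - a ≡ L - b → a ≡ b
minus-injective L a b a∈L L-a≡L-b with a ≟ᶠ b
... | yes a≡b = a≡b
... | no a≢b = ⊥-elim (x∉p-x L a (subst (a ∈_) (sym L-a≡L-b) (x∈p∧x≢y⇒x∈p-y a∈L a≢b)))

minus-cancel : ∀ {N} (p q : Subset N) a → a ∈ p → a ∈ q → p - a ≡ q - a → p ≡ q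
minus-cancel p q a a∈p a∈q p-a≡q-a =
  ⊆-antisym (included p q a∈q p-a≡q-a) (included q p a∈p (sym p-a≡q-a))
  where
  included : ∀ p q → a ∈ q → p - a ≡ q - a → p ⊆ q
  included p q a∈q p-a≡q-a {z} z∈p with z ≟ᶠ a
  ... | yes refl = a∈q
  ... | no z≢a = proj₁ (∈-minus⁻ (subst (z ∈_) p-a≡q-a (x∈p∧x≢y⇒x∈p-y z∈p z≢a)))

minus-∩ : ∀ {N} (p q : Subset N) k → (p - k) ∩ q ≡ (p ∩ q) - k
minus-∩ p q k = ⊆-antisym forward backward
  where
  forward : (p - k) ∩ q ⊆ (p ∩ q) - k
  forward z∈ with x∈p∩q⁻ (p - k) q z∈
  ... | z∈p-k , z∈q with ∈-minus⁻ {p = p} z∈p-k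
  ... | z∈p , z≢k = x∈p∧x≢y⇒x∈p-y (x∈p∩q⁺ (z∈p , z∈q)) z≢k
  backward : (p ∩ q) - k ⊆ (p - k) ∩ q
  backward z∈ with ∈-minus⁻ {p = p ∩ q} z∈
  ... | z∈p∩q , z≢k with x∈p∩q⁻ p q z∈p∩q
  ... | z∈p , z∈q = x∈p∩q⁺ (x∈p∧x≢y⇒x∈p-y z∈p z≢k , z∈q)

common-packet : ∀ {N} {K K' : Subset N} {k x} → k ∈ K → x ∈ K' → x ≢ k →
  K - k ≡ K' - x → (K ∪ ⁅ x ⁆) - x ≡ K × (K ∪ ⁅ x ⁆) - k ≡ K'
common-packet {N} {K} {K'} {k} {x} k∈K x∈K' x≢k K-k≡K'-x =
  ⊆-antisym L-x⊆K K⊆L-x , ⊆-antisym L-k⊆K' K'⊆L-k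
  where
  L : Subset N
  L = K ∪ ⁅ x ⁆
  x∉K : x ∉ K
  x∉K x∈K = x∉p-x K' x (subst (x ∈_) K-k≡K'-x (x∈p∧x≢y⇒x∈p-y x∈K x≢k))
  K'-x⊆K-k : ∀ {z} → z ∈ K' → z ≢ x → z ∈ K × z ≢ k
  K'-x⊆K-k z∈K' z≢x = ∈-minus⁻ (subst (_ ∈_) (sym K-k≡K'-x) (x∈p∧x≢y⇒x∈p-y z∈K' z≢x))
  L-x⊆K : L - x ⊆ K
  L-x⊆K z∈ with ∈-minus⁻ z∈
  ... | z∈L , z≢x with x∈p∪q⁻ K ⁅ x ⁆ z∈L
  ... | inj₁ z∈K = z∈K
  ... | inj₂ z∈⁅x⁆ = ⊥-elim (z≢x (x∈⁅y⁆⇒x≡y x z∈⁅x⁆))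
  K⊆L-x : K ⊆ L - x
  K⊆L-x z∈K = x∈p∧x≢y⇒x∈p-y (x∈p∪q⁺ (inj₁ z∈K)) (λ { refl → x∉K z∈K })
  L-k⊆K' : L - k ⊆ K'
  L-k⊆K' z∈ with ∈-minus⁻ z∈
  ... | z∈L , z≢k with x∈p∪q⁻ K ⁅ x ⁆ z∈L
  ... | inj₁ z∈K = proj₁ (∈-minus⁻ (subst (_ ∈_) K-k≡K'-x (x∈p∧x≢y⇒x∈p-y z∈K z≢k)))
  ... | inj₂ z∈⁅x⁆ = subst (_∈ K') (sym (x∈⁅y⁆⇒x≡y x z∈⁅x⁆)) x∈K'
  K'⊆L-k : K' ⊆ L - k
  K'⊆L-k {z} z∈K' with z ≟ᶠ x
  ... | yes refl = x∈p∧x≢y⇒x∈p-y (x∈p∪q⁺ (inj₂ (x∈⁅x⁆ x))) x≢k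
  ... | no z≢x with K'-x⊆K-k z∈K' z≢x
  ... | z∈K , z≢k = x∈p∧x≢y⇒x∈p-y (x∈p∪q⁺ (inj₁ z∈K)) z≢k

-- below k is empty for k = 0: no point lies in the all-false subset,
-- and that subset meets every set in no point
∉-all-false : ∀ {N} (x : Fin N) → x ∉ tabulate {n = N} (λ _ → false)
∉-all-false zero ()
∉-all-false (suc x) (there x∈) = ∉-all-false x x∈

∣p∩all-false∣≡0 : ∀ {N} (p : Subset N) → ∣ p ∩ tabulate (λ _ → false) ∣ ≡ 0
∣p∩all-false∣≡0 [] = refl
∣p∩all-false∣≡0 (true ∷ p) = ∣p∩all-false∣≡0 p
∣p∩all-false∣≡0 (false ∷ p) = ∣p∩all-false∣≡0 p

below⁺ : ∀ {N} {x k : Fin N} → x <ᶠ k → x ∈ below k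
below⁺ {x = zero} {suc k} _ = here
below⁺ {x = suc x} {suc k} (s≤s x<k) = there (below⁺ x<k)

below⁻ : ∀ {N} {x k : Fin N} → x ∈ below k → x <ᶠ k
below⁻ {x = zero} {suc k} _ = s≤s z≤n
below⁻ {x = suc x} {suc k} (there x∈) = s≤s (below⁻ x∈)
below⁻ {x = suc x} {zero} (there x∈) = ⊥-elim (∉-all-false x x∈)

element-of-rank : ∀ {N} (S : Subset N) j → j < ∣ S ∣ →
  Σ (Fin N) λ x → x ∈ S × ∣ S ∩ below x ∣ ≡ j
element-of-rank (true ∷ S) zero _ = zero , here , ∣p∩all-false∣≡0 S
element-of-rank (true ∷ S) (suc j) (s≤s j<∣S∣) with element-of-rank S j j<∣S∣
... | x , x∈S , rank = suc x , there x∈S , cong suc rank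
element-of-rank (false ∷ S) j j<∣S∣ with element-of-rank S j j<∣S∣
... | x , x∈S , rank = suc x , there x∈S , rank

_≡₂_ : ℕ → ℕ → Set
a ≡₂ b = a % 2 ≡ b % 2

parity : ∀ a → (a % 2 ≡ 0 × suc a % 2 ≡ 1) ⊎ (a % 2 ≡ 1 × suc a % 2 ≡ 0)
parity zero = inj₁ (refl , refl)
parity (suc zero) = inj₂ (refl , refl)
parity (suc (suc a)) = parity a

≢₂-suc : ∀ a → ¬ (a ≡₂ suc a)
≢₂-suc a a≡₂sa with parity a
... | inj₁ (a0 , sa1) = 0≢1+n (trans (sym a0) (trans a≡₂sa sa1))
... | inj₂ (a1 , sa0) = 1+n≢0 (trans (sym a1) (trans a≡₂sa sa0))

≡₂-dichotomy : ∀ a b → a ≡₂ b ⊎ a ≡₂ suc b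
≡₂-dichotomy a b with parity a | parity b
... | inj₁ (a0 , _) | inj₁ (b0 , _) = inj₁ (trans a0 (sym b0))
... | inj₂ (a1 , _) | inj₂ (b1 , _) = inj₁ (trans a1 (sym b1))
... | inj₁ (a0 , _) | inj₂ (_ , sb0) = inj₂ (trans a0 (sym sb0))
... | inj₂ (a1 , _) | inj₁ (_ , sb1) = inj₂ (trans a1 (sym sb1))

≡₂-suc⁻ : ∀ a b → suc a ≡₂ suc b → a ≡₂ b
≡₂-suc⁻ a b sa≡₂sb with parity a | parity b
... | inj₁ (a0 , _) | inj₁ (b0 , _) = trans a0 (sym b0)
... | inj₂ (a1 , _) | inj₂ (b1 , _) = trans a1 (sym b1)
... | inj₁ (_ , sa1) | inj₂ (_ , sb0) = ⊥-elim (1+n≢0 (trans (sym sa1) (trans sa≡₂sb sb0)))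
... | inj₂ (_ , sa0) | inj₁ (_ , sb1) = ⊥-elim (0≢1+n (trans (sym sa0) (trans sa≡₂sb sb1)))

sides-exclusive : ∀ {N} {S : Subset N} {k} → InLt S k → InGt S k → ⊥
sides-exclusive {S = S} {k} (k∈S , lt) (_ , gt) =
  exclusive ∣ S ∣ (subst (1 ≤_) (sym (∣p∣≡1+∣p-x∣ S k k∈S)) (s≤s z≤n)) (trans (sym lt) gt)
  where
  exclusive : ∀ c → 1 ≤ c → ¬ ((c ∸ 1) ≡₂ c)
  exclusive (suc c) _ = ≢₂-suc c

sides-cover : ∀ {N} (S : Subset N) k → k ∈ S → InLt S k ⊎ InGt S k
sides-cover S k k∈S with ≡₂-dichotomy (pos S k) ∣ S - k ∣
... | inj₁ lt = inj₁ (k∈S , subst (λ c → pos S k ≡₂ (c ∸ 1)) (sym (∣p∣≡1+∣p-x∣ S k k∈S)) lt)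
... | inj₂ gt = inj₂ (k∈S , subst (pos S k ≡₂_) (sym (∣p∣≡1+∣p-x∣ S k k∈S)) gt)

-- S_< is nonempty once ∣ S ∣ ≥ 2: the second largest point lies in it
InLt-nonempty : ∀ {N n} {S : Subset N} → ∣ S ∣ ≡ suc n → 1 ≤ n → Σ (Fin N) (InLt S)
InLt-nonempty {n = suc m} {S} ∣S∣ _
  with element-of-rank S m (subst (m <_) (sym ∣S∣) (n≤1+n (suc m)))
... | k , k∈S , rank = k , k∈S , cong (_% 2) (trans (cong suc rank) (cong (_∸ 1) (sym ∣S∣)))

-- Removing a point r ≠ o from L changes the side of o in a controlled way: if
-- r < o, position and size of o both drop by one and the side is kept; if r > o,
-- only the size drops and the side flips.
module RemovePoint {N} (L : Subset N) (r o : Fin N) (r∈L : r ∈ L) (o∈L : o ∈ L) (o≢r : o ≢ r) where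

  o∈L-r : o ∈ L - r
  o∈L-r = x∈p∧x≢y⇒x∈p-y o∈L o≢r

  size : ∣ L ∣ ≡ suc ∣ L - r ∣
  size = ∣p∣≡1+∣p-x∣ L r r∈L

  1≤∣L-r∣ : 1 ≤ ∣ L - r ∣
  1≤∣L-r∣ = subst (1 ≤_) (sym (∣p∣≡1+∣p-x∣ (L - r) o o∈L-r)) (s≤s z≤n)

  pos-smaller : r <ᶠ o → pos L o ≡ suc (pos (L - r) o)
  pos-smaller r<o = cong suc (trans
    (∣p∣≡1+∣p-x∣ (L ∩ below o) r (x∈p∩q⁺ (r∈L , below⁺ r<o)))
    (cong (λ X → suc ∣ X ∣) (sym (minus-∩ L (below o) r))))

  pos-larger : o <ᶠ r → pos L o ≡ pos (L - r) o
  pos-larger o<r = cong suc (sym (trans (cong ∣_∣ (minus-∩ L (below o) r))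
    (cong ∣_∣ (p-x≡p (L ∩ below o) r
      (λ r∈ → <-asym o<r (below⁻ (proj₂ (x∈p∩q⁻ L (below o) r∈))))))))

  drop-smaller-Lt : r <ᶠ o → InLt L o → InLt (L - r) o
  drop-smaller-Lt r<o (_ , lt) = o∈L-r , shift 1≤∣L-r∣
    (subst₂ _≡₂_ (pos-smaller r<o) (cong (_∸ 1) size) lt)
    where
    shift : ∀ {c} → 1 ≤ c → suc (pos (L - r) o) ≡₂ (suc c ∸ 1) → pos (L - r) o ≡₂ (c ∸ 1)
    shift {suc c} _ = ≡₂-suc⁻ (pos (L - r) o) c

  drop-smaller-Gt : r <ᶠ o → InGt L o → InGt (L - r) o
  drop-smaller-Gt r<o (_ , gt) =
    o∈L-r , ≡₂-suc⁻ (pos (L - r) o) ∣ L - r ∣ (subst₂ _≡₂_ (pos-smaller r<o) size gt)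

  drop-larger-Lt : o <ᶠ r → InLt L o → InGt (L - r) o
  drop-larger-Lt o<r (_ , lt) = o∈L-r , subst₂ _≡₂_ (pos-larger o<r) (cong (_∸ 1) size) lt

  drop-larger-Gt : o <ᶠ r → InGt L o → InLt (L - r) o
  drop-larger-Gt o<r (_ , gt) = o∈L-r , shift 1≤∣L-r∣ (subst₂ _≡₂_ (pos-larger o<r) size gt)
    where
    shift : ∀ {c} → 1 ≤ c → pos (L - r) o ≡₂ suc c → pos (L - r) o ≡₂ (c ∸ 1)
    -- suc (suc c) % 2 reduces to c % 2
    shift {suc c} _ p≡₂ssc = p≡₂ssc

-- h is closed upwards on L for the strict order ≺.  With h l = [L ∖ {l} ∈ U],
-- "Upward _<ᶠ_" is Beginning U L and "Upward (flip _<ᶠ_)" is Ending U L.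
Upward : ∀ {N} → Rel (Fin N) 0ℓ → Subset N → (Fin N → Bool) → Set
Upward _≺_ L h = ∀ l l' → l ∈ L → l' ∈ L → l ≺ l' → h l ≡ true → h l' ≡ true

ending⇒upward : ∀ {N} {U : Family N} {L} → Ending U L → Upward (flip _<ᶠ_) L (λ l → U (L - l))
ending⇒upward end l l' l∈L l'∈L l'<l = end l' l l'∈L l∈L l'<l

upward⇒ending : ∀ {N} {U : Family N} {L} → Upward (flip _<ᶠ_) L (λ l → U (L - l)) → Ending U L
upward⇒ending up l l' l∈L l'∈L l<l' = up l' l l'∈L l∈L l<l'

module AddToPacket {N} (_≺_ : Rel (Fin N) 0ℓ) (compare : Trichotomous _≡_ _≺_)
  (L : Subset N) (g g' : Fin N → Bool) (y : Fin N) (y∈L : y ∈ L)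
  (gy : g y ≡ false) (g'y : g' y ≡ true)
  (g⇒g' : ∀ a → g a ≡ true → g' a ≡ true)
  (g'⇒g : ∀ a → a ∈ L → a ≢ y → g' a ≡ true → g a ≡ true) where

  Segment : (Fin N → Bool) → Set
  Segment h = Upward _≺_ L h ⊎ Upward (flip _≺_) L h

  private
    ≺⇒≢ : ∀ {a b} → a ≺ b → a ≢ b
    ≺⇒≢ a≺b a≡b = tri⇒irr compare a≡b a≺b

  true-below : Segment g → Segment g' → ¬ (Upward _≺_ L g × Upward _≺_ L g') →
    ∀ k → k ∈ L → k ≺ y → g k ≡ true
  true-below seg seg' not-both k k∈L k≺y = ¬-not (refute seg seg')
    where
    refute : Segment g → Segment g' → g k ≢ false
    refute _ (inj₂ down') gk = not-¬ (g'⇒g k k∈L (≺⇒≢ k≺y) (down' y k y∈L k∈L k≺y g'y)) gk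
    refute (inj₁ up) (inj₁ up') _ = not-both (up , up')
    refute (inj₂ down) (inj₁ up') gk = not-both (vacuous , up')
      where
      -- g vanishes on L: below k it would force g' k, above k it would force g k
      nowhere : ∀ l → l ∈ L → g l ≢ true
      nowhere l l∈L gl with compare l k
      ... | tri< l≺k _ _ = not-¬ (g'⇒g k k∈L (≺⇒≢ k≺y) (up' l k l∈L k∈L l≺k (g⇒g' l gl))) gk
      ... | tri≈ _ refl _ = not-¬ gl gk
      ... | tri> _ _ k≺l = not-¬ (down l k l∈L k∈L k≺l gl) gk
      vacuous : Upward _≺_ L g
      vacuous l _ l∈L _ _ gl = ⊥-elim (nowhere l l∈L gl)

  false-above : Segment g → Segment g' → ¬ (Upward _≺_ L g × Upward _≺_ L g') →
    ∀ k → k ∈ L → y ≺ k → g k ≡ false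
  false-above seg seg' not-both k k∈L y≺k = ¬-not (refute seg seg')
    where
    refute : Segment g → Segment g' → g k ≢ true
    refute (inj₂ down) _ gk = not-¬ (down k y k∈L y∈L y≺k gk) gy
    refute (inj₁ up) (inj₁ up') _ = not-both (up , up')
    refute (inj₁ up) (inj₂ down') gk = not-both (up , λ _ l' _ l'∈L _ _ → everywhere l' l'∈L)
      where
      -- g' is true on all of L: below k by down-closure, above k by g's up-closure
      everywhere : ∀ l → l ∈ L → g' l ≡ true
      everywhere l l∈L with compare l k
      ... | tri< l≺k _ _ = down' k l k∈L l∈L l≺k (g⇒g' k gk)
      ... | tri≈ _ refl _ = g⇒g' k gk
      ... | tri> _ _ k≺l = g⇒g' l (up k l k∈L l∈L k≺l gk)

Edge : ∀ {N} → Family N → Subset N → Family N → Set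
Edge U K U' = K ∉F U × K ∈F U' × (∀ X → X ≢ K → U' X ≡ U X)

-- Side b U X x : either x ∈ X_< and [X ∈ U] = b, or x ∈ X_> and [X ∈ U] = not b.
-- X ∖ {x} is non-visible for U through (X, x) exactly when Side false U X x.
Side : ∀ {N} → Bool → Family N → Subset N → Fin N → Set
Side b U X x = (U X ≡ b × InLt X x) ⊎ (U X ≡ not b × InGt X x)

side-exclusive : ∀ {N} (U : Family N) {X x} → Side true U X x → Side false U X x → ⊥
side-exclusive _ (inj₁ (t , _)) (inj₁ (f , _)) = not-¬ t f
side-exclusive _ (inj₁ (_ , lt)) (inj₂ (_ , gt)) = sides-exclusive lt gt
side-exclusive _ (inj₂ (_ , gt)) (inj₁ (_ , lt)) = sides-exclusive lt gt
side-exclusive _ (inj₂ (f , _)) (inj₂ (t , _)) = not-¬ t f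

side-resp : ∀ {N} (U V : Family N) {X x} b → U X ≡ V X → Side b U X x → Side b V X x
side-resp _ _ _ UX≡VX (inj₁ (UX , lt)) = inj₁ (trans (sym UX≡VX) UX , lt)
side-resp _ _ _ UX≡VX (inj₂ (UX , gt)) = inj₂ (trans (sym UX≡VX) UX , gt)

visible-side : ∀ {N n} {U U' : Family N} {K L : Subset N} {x k : Fin N} →
  Consistent N n U → Consistent N n U' → Edge U K U' →
  ∣ L ∣ ≡ suc (suc n) → x ∈ L → K ≡ L - x → ¬ NonVisibleEdge N n U K U' →
  k ∈ L → k ≢ x → Side true U (L - k) x
visible-side {N} {n} {U} {U'} {K} {L} {x} {k}
  consistent consistent' (K∉U , K∈U' , unchanged) ∣L∣ x∈L K≡L-x visible k∈L k≢x =
  by-side (sides-cover L x x∈L) (<-cmp k x)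
  where
  g g' : Fin N → Bool
  g l = U (L - l)
  g' l = U' (L - l)
  g⇒g' : ∀ a → g a ≡ true → g' a ≡ true
  g⇒g' a ga with (L - a) ≟ˢ K
  ... | yes L-a≡K = subst (λ X → U' X ≡ true) (sym L-a≡K) K∈U'
  ... | no L-a≢K = trans (unchanged _ L-a≢K) ga
  g'⇒g : ∀ a → a ∈ L → a ≢ x → g' a ≡ true → g a ≡ true
  g'⇒g a a∈L a≢x g'a = trans (sym (unchanged _ L-a≢K)) g'a
    where
    L-a≢K : L - a ≢ K
    L-a≢K L-a≡K = a≢x (minus-injective L a x a∈L (trans L-a≡K K≡L-x))
  gx : g x ≡ false
  gx = subst (λ X → U X ≡ false) K≡L-x K∉U
  g'x : g' x ≡ true
  g'x = subst (λ X → U' X ≡ true) K≡L-x K∈U'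
  module Lex = AddToPacket _<ᶠ_ <-cmp L g g' x x∈L gx g'x g⇒g' g'⇒g
  module Colex = AddToPacket (flip _<ᶠ_) (Flip.compare _<ᶠ_ <-cmp) L g g' x x∈L gx g'x g⇒g' g'⇒g
  segment : ∀ {V : Family N} → Consistent N n V → Lex.Segment (λ l → V (L - l))
  segment {V} (_ , beginning-or-ending) with beginning-or-ending L ∣L∣
  ... | inj₁ beginning = inj₁ beginning
  ... | inj₂ ending = inj₂ (ending⇒upward {U = V} ending)
  not-both-beginning : InLt L x → ¬ (Upward _<ᶠ_ L g × Upward _<ᶠ_ L g')
  not-both-beginning x∈L< (b , b') = visible (L , ∣L∣ , x , x∈L , K≡L-x , inj₁ (x∈L< , b , b'))
  not-both-ending : InGt L x → ¬ (Upward (flip _<ᶠ_) L g × Upward (flip _<ᶠ_) L g')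
  not-both-ending x∈L> (e , e') =
    visible (L , ∣L∣ , x , x∈L , K≡L-x , inj₂ (x∈L> , upward⇒ending {U = U} e , upward⇒ending {U = U'} e'))
  open RemovePoint L k x k∈L x∈L (λ x≡k → k≢x (sym x≡k))
  by-side : InLt L x ⊎ InGt L x → Tri (k <ᶠ x) (k ≡ x) (x <ᶠ k) → Side true U (L - k) x
  by-side _ (tri≈ _ k≡x _) = ⊥-elim (k≢x k≡x)
  by-side (inj₁ x∈L<) (tri< k<x _ _) = inj₁
    ( Lex.true-below (segment consistent) (segment consistent') (not-both-beginning x∈L<) k k∈L k<x
    , drop-smaller-Lt k<x x∈L< )
  by-side (inj₁ x∈L<) (tri> _ _ x<k) = inj₂
    ( Lex.false-above (segment consistent) (segment consistent') (not-both-beginning x∈L<) k k∈L x<k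
    , drop-larger-Lt x<k x∈L< )
  by-side (inj₂ x∈L>) (tri< k<x _ _) = inj₂
    ( Colex.false-above (swap (segment consistent)) (swap (segment consistent')) (not-both-ending x∈L>) k k∈L k<x
    , drop-smaller-Gt k<x x∈L> )
  by-side (inj₂ x∈L>) (tri> _ _ x<k) = inj₁
    ( Colex.true-below (swap (segment consistent)) (swap (segment consistent')) (not-both-ending x∈L>) k k∈L x<k
    , drop-larger-Gt x<k x∈L> )

visible-edge⇒visible-facet : ∀ {N n} {U U' : Family N} {K : Subset N} {k} →
  Consistent N n U → Consistent N n U' → Edge U K U' → ∣ K ∣ ≡ suc n →
  ¬ NonVisibleEdge N n U K U' → InLt K k → ¬ NonVisible N n U' (K - k)
visible-edge⇒visible-facet {N} {n} {U} {U'} {K} {k}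
  consistent consistent' edge ∣K∣ visible k∈K< (K' , _ , x , x∈K' , K-k≡K'-x , hidden)
  with x ≟ᶠ k
... | yes refl = side-exclusive U' (subst (λ X → Side true U' X k) K≡K' (inj₁ (K∈U' , k∈K<))) hidden
  where
  K∈U' : K ∈F U'
  K∈U' = proj₁ (proj₂ edge)
  K≡K' : K ≡ K'
  K≡K' = minus-cancel K K' k (proj₁ k∈K<) x∈K' K-k≡K'-x
... | no x≢k = side-exclusive U' side-in-U' hidden
  where
  k∈K : k ∈ K
  k∈K = proj₁ k∈K<
  L : Subset N
  L = K ∪ ⁅ x ⁆
  x∈L : x ∈ L
  x∈L = x∈p∪q⁺ (inj₂ (x∈⁅x⁆ x))
  k∈L : k ∈ L
  k∈L = x∈p∪q⁺ (inj₁ k∈K)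
  L-x≡K : L - x ≡ K
  L-x≡K = proj₁ (common-packet k∈K x∈K' x≢k K-k≡K'-x)
  L-k≡K' : L - k ≡ K'
  L-k≡K' = proj₂ (common-packet k∈K x∈K' x≢k K-k≡K'-x)
  ∣L∣ : ∣ L ∣ ≡ suc (suc n)
  ∣L∣ = trans (∣p∣≡1+∣p-x∣ L x x∈L) (cong suc (trans (cong ∣_∣ L-x≡K) ∣K∣))
  side-in-U : Side true U (L - k) x
  side-in-U = visible-side consistent consistent' edge ∣L∣ x∈L (sym L-x≡K) visible
    k∈L (λ k≡x → x≢k (sym k≡x))
  K'≢K : K' ≢ K
  K'≢K K'≡K = x≢k (sym (minus-injective L k x k∈L (trans L-k≡K' (trans K'≡K (sym L-x≡K)))))
  side-in-U' : Side true U' K' x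
  side-in-U' = side-resp U U' true (sym (proj₂ (proj₂ edge) K' K'≢K))
    (subst (λ X → Side true U X x) L-k≡K' side-in-U)

-- Lemma B.  Across a non-visible edge U --K--> U', every facet K ∖ {x} with
-- x ∈ K is non-visible for U, witnessed by the packet L ∖ {x} and the point y.
non-visible-edge⇒hidden-facets : ∀ {N n} {U U' : Family N} {K : Subset N} →
  Edge U K U' → NonVisibleEdge N n U K U' → ∀ x → x ∈ K → NonVisible N n U (K - x)
non-visible-edge⇒hidden-facets {N} {n} {U} {U'} {K}
  (K∉U , K∈U' , unchanged) (L , ∣L∣ , y , y∈L , K≡L-y , witness) x x∈K =
  L - x , ∣L-x∣ , y , y∈L-x , K-x≡L-x-y , by-side witness (<-cmp x y)
  where
  x∈L : x ∈ L
  x∈L = proj₁ (∈-minus⁻ (subst (x ∈_) K≡L-y x∈K))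
  x≢y : x ≢ y
  x≢y = proj₂ (∈-minus⁻ (subst (x ∈_) K≡L-y x∈K))
  y∈L-x : y ∈ L - x
  y∈L-x = x∈p∧x≢y⇒x∈p-y y∈L (λ y≡x → x≢y (sym y≡x))
  ∣L-x∣ : ∣ L - x ∣ ≡ suc n
  ∣L-x∣ = suc-injective (trans (sym (∣p∣≡1+∣p-x∣ L x x∈L)) ∣L∣)
  K-x≡L-x-y : K - x ≡ L - x - y
  K-x≡L-x-y = trans (cong (_- x) K≡L-y) (p─x─y≡p─y─x L y x)
  L-x≢K : L - x ≢ K
  L-x≢K L-x≡K = x≢y (minus-injective L x y x∈L (trans L-x≡K K≡L-y))
  U[L-y] : U (L - y) ≡ false
  U[L-y] = subst (λ X → U X ≡ false) K≡L-y K∉U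
  U'[L-y] : U' (L - y) ≡ true
  U'[L-y] = subst (λ X → U' X ≡ true) K≡L-y K∈U'
  open RemovePoint L x y x∈L y∈L (λ y≡x → x≢y (sym y≡x))
  by-side : (InLt L y × Beginning U L × Beginning U' L) ⊎ (InGt L y × Ending U L × Ending U' L) →
    Tri (x <ᶠ y) (x ≡ y) (y <ᶠ x) → Side false U (L - x) y
  by-side _ (tri≈ _ x≡y _) = ⊥-elim (x≢y x≡y)
  by-side (inj₁ (y∈L< , beginning , _)) (tri< x<y _ _) = inj₁
    ( ¬-not (λ U[L-x] → not-¬ (beginning x y x∈L y∈L x<y U[L-x]) U[L-y])
    , drop-smaller-Lt x<y y∈L< )
  by-side (inj₁ (y∈L< , _ , beginning')) (tri> _ _ y<x) = inj₂
    ( trans (sym (unchanged _ L-x≢K)) (beginning' y x y∈L x∈L y<x U'[L-y])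
    , drop-larger-Lt y<x y∈L< )
  by-side (inj₂ (y∈L> , _ , ending')) (tri< x<y _ _) = inj₂
    ( trans (sym (unchanged _ L-x≢K)) (ending' x y x∈L y∈L x<y U'[L-y])
    , drop-smaller-Gt x<y y∈L> )
  by-side (inj₂ (y∈L> , ending , _)) (tri> _ _ y<x) = inj₁
    ( ¬-not (λ U[L-x] → not-¬ (ending y x y∈L x∈L y<x U[L-x]) U[L-y])
    , drop-larger-Gt y<x y∈L> )

lost-visibility⇒visible-edge : ∀ {N n} {U U' : Family N} {K I : Subset N} →
  Edge U K U' → ¬ NonVisible N n U I → NonVisible N n U' I → ¬ NonVisibleEdge N n U K U'
lost-visibility⇒visible-edge {U = U} {U'} {K} edge visible-before
  (K' , ∣K'∣ , x , x∈K' , I≡K'-x , hidden) non-visible with K' ≟ˢ K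
... | no K'≢K = visible-before
  (K' , ∣K'∣ , x , x∈K' , I≡K'-x , side-resp U' U false (proj₂ (proj₂ edge) K' K'≢K) hidden)
... | yes refl = visible-before (subst (NonVisible _ _ U) (sym I≡K'-x)
  (non-visible-edge⇒hidden-facets edge non-visible x x∈K'))

interval-induction : (P : ℕ → Set) {s r : ℕ} → P s →
  (∀ t → suc t ≤ r → P t → P (suc t)) → ∀ t → s ≤ t → t ≤ r → P t
interval-induction P base step zero z≤n _ = base
interval-induction P base step (suc t) s≤1+t 1+t≤r with m≤n⇒m<n∨m≡n s≤1+t
... | inj₂ refl = base
... | inj₁ (s≤s s≤t) =
  step t 1+t≤r (interval-induction P base step t s≤t (≤-trans (n≤1+n t) 1+t≤r))

module Chain {N n r : ℕ} (1≤n : 1 ≤ n) (U : ℕ → Family N) (K : ℕ → Subset N)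
  (consistent : ∀ s → s ≤ r → Consistent N n (U s))
  (edge : ∀ s → 1 ≤ s → s ≤ r → Edge (U (s ∸ 1)) (K s) (U s)) where

  NewlyVisible : ℕ → Set
  NewlyVisible t = Σ (Subset N) λ I → InR N n (U t) I × ¬ InR N n (U 0) I

  monotone : ∀ t → t ≤ r → ∀ X → X ∈F U 0 → X ∈F U t
  monotone zero _ X X∈U₀ = X∈U₀
  monotone (suc t) 1+t≤r X X∈U₀ with X ≟ˢ K (suc t)
  ... | yes refl = proj₁ (proj₂ (edge (suc t) (s≤s z≤n) 1+t≤r))
  ... | no X≢K = trans (proj₂ (proj₂ (edge (suc t) (s≤s z≤n) 1+t≤r)) X X≢K)
    (monotone t (≤-trans (n≤1+n t) 1+t≤r) X X∈U₀)

  visible-edge⇒newly-visible : ∀ t → 1 ≤ t → t ≤ r →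
    ¬ NonVisibleEdge N n (U (t ∸ 1)) (K t) (U t) → NewlyVisible t
  visible-edge⇒newly-visible t 1≤t t≤r visible = K t - k , (∣I∣ , visible-for-U) , hidden-for-U₀
    where
    t-1≤r : t ∸ 1 ≤ r
    t-1≤r = ≤-trans (m∸n≤m t 1) t≤r
    K∉U : K t ∉F U (t ∸ 1)
    K∉U = proj₁ (edge t 1≤t t≤r)
    ∣K∣ : ∣ K t ∣ ≡ suc n
    ∣K∣ = proj₁ (consistent t t≤r) (K t) (proj₁ (proj₂ (edge t 1≤t t≤r)))
    k : Fin N
    k = proj₁ (InLt-nonempty ∣K∣ 1≤n)
    k∈K< : InLt (K t) k
    k∈K< = proj₂ (InLt-nonempty ∣K∣ 1≤n)
    ∣I∣ : ∣ K t - k ∣ ≡ n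
    ∣I∣ = suc-injective (trans (sym (∣p∣≡1+∣p-x∣ (K t) k (proj₁ k∈K<))) ∣K∣)
    visible-for-U : ¬ NonVisible N n (U t) (K t - k)
    visible-for-U = visible-edge⇒visible-facet (consistent (t ∸ 1) t-1≤r) (consistent t t≤r)
      (edge t 1≤t t≤r) ∣K∣ visible k∈K<
    K∉U₀ : K t ∉F U 0
    K∉U₀ = ¬-not (λ K∈U₀ → not-¬ (monotone (t ∸ 1) t-1≤r (K t) K∈U₀) K∉U)
    hidden-for-U₀ : ¬ InR N n (U 0) (K t - k)
    hidden-for-U₀ (_ , visible₀) = visible₀ (K t , ∣K∣ , k , proj₁ k∈K< , refl , inj₁ (K∉U₀ , k∈K<))

  -- the invariant survives each step: either the set stays visible, or it is
  -- lost through a visible edge, which produces a new one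
  newly-visible-step : ∀ t → suc t ≤ r → ¬ ¬ NewlyVisible t → ¬ ¬ NewlyVisible (suc t)
  newly-visible-step t 1+t≤r ¬¬new ¬new = ¬¬new keep
    where
    still-visible : ∀ I → ¬ NonVisible N n (U t) I → ¬ NonVisible N n (U (suc t)) I
    still-visible I visible hidden = ¬new (visible-edge⇒newly-visible (suc t) (s≤s z≤n) 1+t≤r
      (lost-visibility⇒visible-edge (edge (suc t) (s≤s z≤n) 1+t≤r) visible hidden))
    keep : ¬ NewlyVisible t
    keep (I , (∣I∣ , visible) , hidden₀) = ¬new (I , (∣I∣ , still-visible I visible) , hidden₀)

corollary4p6 : (N n : ℕ) → 1 ≤ n → suc n ≤ N →
    (r : ℕ) (U : ℕ → Family N) (K : ℕ → Subset N) →
    (∀ s → s ≤ r → Consistent N n (U s)) →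
    (∀ s → 1 ≤ s → s ≤ r →
       K s ∉F U (s ∸ 1) × K s ∈F U s ×
       (∀ X → X ≢ K s → U s X ≡ U (s ∸ 1) X)) →
    Σ ℕ (λ s → 1 ≤ s × s ≤ r × ¬ NonVisibleEdge N n (U (s ∸ 1)) (K s) (U s)) →
    ¬ SameR N n (U 0) (U r)
corollary4p6 N n 1≤n _ r U K consistent edge (s , 1≤s , s≤r , visible) same-R =
  newly-visible-at-r λ where
    (I , I∈R[U_r] , I∉R[U₀]) → I∉R[U₀] (proj₂ (proj₁ same-R I) I∈R[U_r])
  where
  open Chain 1≤n U K consistent edge
  newly-visible-at-r : ¬ ¬ NewlyVisible r
  newly-visible-at-r = interval-induction (λ t → ¬ ¬ NewlyVisible t)
    (λ ¬new → ¬new (visible-edge⇒newly-visible s 1≤s s≤r visible))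
    newly-visible-step r s≤r ≤-refl
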